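{- For any formulas $\alpha,\beta$ over a finite signature $\Sigma$: if $[\![\alpha]\!]_c\subseteq[\![\beta]\!]_c$ and $[\![\beta]\!]\subseteq[\![\alpha]\!]$, then $\alpha$ strongly entails $\beta$.
   Context: $\Sigma$ is a finite set of atoms. Formulas are given by $\alpha ::= \bot \mid p \mid \alpha_1\wedge\alpha_2 \mid \alpha_1\vee\alpha_2 \mid \alpha_1\rightarrow\alpha_2$ with $p\in\Sigma$. A partial interpretation is a map $v:\Sigma\to\{0,1,2\}$; $\mathcal I$ is the set of all of them and $\mathcal I_c$ the set of classical ones (no atom mapped to $1$). The $G_3$ valuation extends $v$ to formulas: $v(\bot)=0$, $v(\alpha\wedge\beta)=\min(v(\alpha),v(\beta))$, $v(\alpha\vee\beta)=\max(v(\alpha),v(\beta))$, $v(\alpha\to\beta)=2$ if $v(\alpha)\le v(\beta)$ and $=v(\beta)$ otherwise; $v$ is a model of $\alpha$ iff $v(\alpha)=2$. The order on $\mathcal I$: $u\le v$ iff for every atom $p$, $u(p)\le v(p)$ and ($u(p)=0$ implies $v(p)=0$). A classical interpretation is an equilibrium model of $\alpha$ iff it is a $\le$-minimal model of $\alpha$; $[\![\alpha]\!]_e$ is the set of equilibrium models of $\alpha$. For $S\subseteq\mathcal I$: $\overline S=\mathcal I\setminus S$; $S_c=S\cap\mathcal I_c$; $S\downarrow=\{u\in\mathcal I:\exists v\in S,\ v\ge u\}$. The denotation: $[\![\bot]\!]=\emptyset$; $[\![p]\!]=\{v\in\mathcal I: v(p)=2\}$; $[\![\alpha\wedge\beta]\!]=[\![\alpha]\!]\cap[\![\beta]\!]$;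 $[\![\alpha\vee\beta]\!]=[\![\alpha]\!]\cup[\![\beta]\!]$; $[\![\alpha\to\beta]\!]=\big(\overline{[\![\alpha]\!]}\cup[\![\beta]\!]\big)\cap\big((\overline{[\![\alpha]\!]}\cup[\![\beta]\!])_c\big)\downarrow$; $[\![\alpha]\!]_c=[\![\alpha]\!]\cap\mathcal I_c$. We say $\alpha$ strongly entails $\beta$ iff for every formula $\gamma$ over $\Sigma$, $[\![\alpha\wedge\gamma]\!]_e\subseteq[\![\beta\wedge\gamma]\!]_e$. -}

module Defs where

open import Data.Nat using (ℕ)
open import Data.Fin using (Fin)
open import Data.Product using (_×_; Σ; ∃)
open import Data.Sum using (_⊎_)
open import Data.Empty using (⊥)
open import Relation.Nullary using (¬_)
open import Relation.Binary.PropositionalEquality using (_≡_)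

-- truth values of G3:  0 , 1 , 2
data V3 : Set where
  v0 v1 v2 : V3

data _≤₃_ : V3 → V3 → Set where
  0≤ : ∀ {x} → v0 ≤₃ x
  1≤1 : v1 ≤₃ v1
  1≤2 : v1 ≤₃ v2
  2≤2 : v2 ≤₃ v2

min₃ : V3 → V3 → V3
min₃ v0 _ = v0
min₃ v1 v0 = v0
min₃ v1 _ = v1
min₃ v2 y = y

max₃ : V3 → V3 → V3
max₃ v0 y = y
max₃ v1 v2 = v2
max₃ v1 _ = v1
max₃ v2 _ = v2

-- G3 implication: 2 if x ≤ y, else y
imp₃ : V3 → V3 → V3
imp₃ v0 _ = v2
imp₃ v1 v0 = v0
imp₃ v1 _ = v2
imp₃ v2 y = y

-- formulas over the signature Σ = Fin n
data Formula (n : ℕ) : Set where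
  ⊥f  : Formula n
  atom : Fin n → Formula n
  _∧f_ _∨f_ _⇒f_ : Formula n → Formula n → Formula n

Interp : ℕ → Set
Interp n = Fin n → V3

Classical : ∀ {n} → Interp n → Set
Classical v = ∀ p → ¬ (v p ≡ v1)

val : ∀ {n} → Interp n → Formula n → V3
val v ⊥f = v0
val v (atom p) = v p
val v (a ∧f b) = min₃ (val v a) (val v b)
val v (a ∨f b) = max₃ (val v a) (val v b)
val v (a ⇒f b) = imp₃ (val v a) (val v b)

Model : ∀ {n} → Interp n → Formula n → Set
Model v a = val v a ≡ v2

_⊑_ : ∀ {n} → Interp n → Interp n → Set
u ⊑ v = ∀ p → (u p ≤₃ v p) × (u p ≡ v0 → v p ≡ v0)

EqModel : ∀ {n} → Formula n → Interp n → Set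
EqModel a v = Classical v × Model v a
  × (∀ u → u ⊑ v → Model u a → ∀ p → u p ≡ v p)

ISet : ℕ → Set₁
ISet n = Interp n → Set

_⊆_ : ∀ {n} → ISet n → ISet n → Set
S ⊆ T = ∀ v → S v → T v

compl : ∀ {n} → ISet n → ISet n
compl S v = ¬ S v

_∩_ _∪_ : ∀ {n} → ISet n → ISet n → ISet n
(S ∩ T) v = S v × T v
(S ∪ T) v = S v ⊎ T v

classPart : ∀ {n} → ISet n → ISet n
classPart S v = S v × Classical v

down : ∀ {n} → ISet n → ISet n
down S u = Σ (Interp _) (λ v → S v × u ⊑ v)

⟦_⟧ : ∀ {n} → Formula n → ISet n
⟦ ⊥f ⟧ v = ⊥
⟦ atom p ⟧ v = v p ≡ v2
⟦ a ∧f b ⟧ = ⟦ a ⟧ ∩ ⟦ b ⟧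
⟦ a ∨f b ⟧ = ⟦ a ⟧ ∪ ⟦ b ⟧
⟦ a ⇒f b ⟧ = (compl ⟦ a ⟧ ∪ ⟦ b ⟧) ∩ down (classPart (compl ⟦ a ⟧ ∪ ⟦ b ⟧))

⟦_⟧c : ∀ {n} → Formula n → ISet n
⟦ a ⟧c = classPart ⟦ a ⟧

⟦_⟧e : ∀ {n} → Formula n → ISet n
⟦ a ⟧e = EqModel a

StronglyEntails : ∀ {n} → Formula n → Formula n → Set
StronglyEntails a b = ∀ g → ⟦ a ∧f g ⟧e ⊆ ⟦ b ∧f g ⟧e

-- Every G3 model of a formula lies in its denotation and conversely: in the
-- implication clause, the only classical interpretation above u is ⌈ u ⌉ᵢ (u
-- with every 1 raised to 2), and raising is a homomorphism of the G3 operations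
-- onto their two-valued restriction, so the classical half of ⟦ α ⇒f β ⟧ checks
-- the implication in ⌈ u ⌉ᵢ exactly as imp₃ does at value 1. Read through models,
-- the hypotheses say that every classical model of α models β and every model of
-- β models α. An equilibrium model v of α ∧f γ therefore models β ∧f γ, and any
-- model of β ∧f γ below v models α ∧f γ, hence coincides with v.
module Submission where

open import Defs
open import Data.Nat using (ℕ)
open import Data.Product using (_×_; _,_; proj₁; proj₂)
open import Data.Sum using (_⊎_; inj₁; inj₂)
open import Data.Empty using (⊥-elim)
open import Relation.Nullary using (¬_)
open import Relation.Binary.PropositionalEquality
  using (_≡_; _≢_; refl; sym; trans; cong; cong₂; module ≡-Reasoning)

⌈_⌉ : V3 → V3
⌈ v0 ⌉ = v0
⌈ v1 ⌉ = v2
⌈ v2 ⌉ = v2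

⌈_⌉ᵢ : ∀ {n} → Interp n → Interp n
⌈ u ⌉ᵢ p = ⌈ u p ⌉

⌈⌉-min₃ : ∀ x y → ⌈ min₃ x y ⌉ ≡ min₃ ⌈ x ⌉ ⌈ y ⌉
⌈⌉-min₃ v0 y  = refl
⌈⌉-min₃ v1 v0 = refl
⌈⌉-min₃ v1 v1 = refl
⌈⌉-min₃ v1 v2 = refl
⌈⌉-min₃ v2 y  = refl

⌈⌉-max₃ : ∀ x y → ⌈ max₃ x y ⌉ ≡ max₃ ⌈ x ⌉ ⌈ y ⌉
⌈⌉-max₃ v0 y  = refl
⌈⌉-max₃ v1 v0 = refl
⌈⌉-max₃ v1 v1 = refl
⌈⌉-max₃ v1 v2 = refl
⌈⌉-max₃ v2 v0 = refl
⌈⌉-max₃ v2 v1 = refl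
⌈⌉-max₃ v2 v2 = refl

⌈⌉-imp₃ : ∀ x y → ⌈ imp₃ x y ⌉ ≡ imp₃ ⌈ x ⌉ ⌈ y ⌉
⌈⌉-imp₃ v0 y  = refl
⌈⌉-imp₃ v1 v0 = refl
⌈⌉-imp₃ v1 v1 = refl
⌈⌉-imp₃ v1 v2 = refl
⌈⌉-imp₃ v2 v0 = refl
⌈⌉-imp₃ v2 v1 = refl
⌈⌉-imp₃ v2 v2 = refl

val-⌈⌉ : ∀ {n} {u w : Interp n} → (∀ p → w p ≡ ⌈ u p ⌉) →
         ∀ a → val w a ≡ ⌈ val u a ⌉
val-⌈⌉ w≡⌈u⌉ ⊥f       = refl
val-⌈⌉ w≡⌈u⌉ (atom p) = w≡⌈u⌉ p
val-⌈⌉ {u = u} w≡⌈u⌉ (a ∧f b) =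
  trans (cong₂ min₃ (val-⌈⌉ w≡⌈u⌉ a) (val-⌈⌉ w≡⌈u⌉ b)) (sym (⌈⌉-min₃ (val u a) (val u b)))
val-⌈⌉ {u = u} w≡⌈u⌉ (a ∨f b) =
  trans (cong₂ max₃ (val-⌈⌉ w≡⌈u⌉ a) (val-⌈⌉ w≡⌈u⌉ b)) (sym (⌈⌉-max₃ (val u a) (val u b)))
val-⌈⌉ {u = u} w≡⌈u⌉ (a ⇒f b) =
  trans (cong₂ imp₃ (val-⌈⌉ w≡⌈u⌉ a) (val-⌈⌉ w≡⌈u⌉ b)) (sym (⌈⌉-imp₃ (val u a) (val u b)))

⌈⌉ᵢ-classical : ∀ {n} (u : Interp n) → Classical ⌈ u ⌉ᵢ
⌈⌉ᵢ-classical u p ⌈up⌉≡v1 with u p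
⌈⌉ᵢ-classical u p () | v0
⌈⌉ᵢ-classical u p () | v1
⌈⌉ᵢ-classical u p () | v2

⊑-⌈⌉ᵢ : ∀ {n} (u : Interp n) → u ⊑ ⌈ u ⌉ᵢ
⊑-⌈⌉ᵢ u p with u p
... | v0 = 0≤  , λ _ → refl
... | v1 = 1≤2 , λ ()
... | v2 = 2≤2 , λ ()

classical-above-≡⌈⌉ : ∀ {x y} → x ≤₃ y → (x ≡ v0 → y ≡ v0) → y ≢ v1 → y ≡ ⌈ x ⌉
classical-above-≡⌈⌉ {v0}      _   x≡v0⇒y≡v0 _    = x≡v0⇒y≡v0 refl
classical-above-≡⌈⌉ {v1} {v1} _   _         y≢v1 = ⊥-elim (y≢v1 refl)
classical-above-≡⌈⌉ {v1} {v2} _   _         _    = refl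
classical-above-≡⌈⌉ {v2} {v2} _   _         _    = refl

classical-⊒-≡⌈⌉ᵢ : ∀ {n} {u w : Interp n} → u ⊑ w → Classical w → ∀ p → w p ≡ ⌈ u p ⌉
classical-⊒-≡⌈⌉ᵢ u⊑w w-classical p =
  classical-above-≡⌈⌉ (proj₁ (u⊑w p)) (proj₂ (u⊑w p)) (w-classical p)

min₃≡v2⇒ : ∀ x y → min₃ x y ≡ v2 → x ≡ v2 × y ≡ v2
min₃≡v2⇒ v0 y  ()
min₃≡v2⇒ v1 v0 ()
min₃≡v2⇒ v1 v1 ()
min₃≡v2⇒ v1 v2 ()
min₃≡v2⇒ v2 y  y≡v2 = refl , y≡v2

⇒min₃≡v2 : ∀ {x y} → x ≡ v2 → y ≡ v2 → min₃ x y ≡ v2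
⇒min₃≡v2 refl refl = refl

max₃≡v2⇒ : ∀ x y → max₃ x y ≡ v2 → x ≡ v2 ⊎ y ≡ v2
max₃≡v2⇒ v0 y  y≡v2 = inj₂ y≡v2
max₃≡v2⇒ v1 v0 ()
max₃≡v2⇒ v1 v1 ()
max₃≡v2⇒ v1 v2 _    = inj₂ refl
max₃≡v2⇒ v2 y  _    = inj₁ refl

⇒max₃≡v2 : ∀ {x y} → x ≡ v2 ⊎ y ≡ v2 → max₃ x y ≡ v2
⇒max₃≡v2 {v2}      (inj₁ refl) = refl
⇒max₃≡v2 {v0}      (inj₂ y≡v2) = y≡v2
⇒max₃≡v2 {v1} {v2} (inj₂ refl) = refl
⇒max₃≡v2 {v2}      (inj₂ _)    = refl

imp₃≡v2⇒ : ∀ x y → imp₃ x y ≡ v2 → x ≢ v2 ⊎ y ≡ v2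
imp₃≡v2⇒ v0 y _    = inj₁ λ ()
imp₃≡v2⇒ v1 y _    = inj₁ λ ()
imp₃≡v2⇒ v2 y y≡v2 = inj₂ y≡v2

-- The two premises mirror the two halves of ⟦ a ⇒f b ⟧: at u and at ⌈ u ⌉ᵢ.
⇒imp₃≡v2 : ∀ x y → x ≢ v2 ⊎ y ≡ v2 → ⌈ x ⌉ ≢ v2 ⊎ ⌈ y ⌉ ≡ v2 → imp₃ x y ≡ v2
⇒imp₃≡v2 v0 y  _           _                = refl
⇒imp₃≡v2 v1 v0 _           (inj₁ ⌈x⌉≢v2)    = ⊥-elim (⌈x⌉≢v2 refl)
⇒imp₃≡v2 v1 v0 _           (inj₂ ())
⇒imp₃≡v2 v1 v1 _           _                = refl
⇒imp₃≡v2 v1 v2 _           _                = refl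
⇒imp₃≡v2 v2 y  (inj₁ x≢v2) _                = ⊥-elim (x≢v2 refl)
⇒imp₃≡v2 v2 y  (inj₂ y≡v2) _                = y≡v2

MaterialImplication : ∀ {n} → Interp n → Formula n → Formula n → Set
MaterialImplication w a b = ¬ Model w a ⊎ Model w b

mutual
  model⇒⟦⟧ : ∀ {n} (a : Formula n) (u : Interp n) → Model u a → ⟦ a ⟧ u
  model⇒⟦⟧ ⊥f       u ()
  model⇒⟦⟧ (atom p) u u⊨p = u⊨p
  model⇒⟦⟧ (a ∧f b) u u⊨a∧b with min₃≡v2⇒ (val u a) (val u b) u⊨a∧b
  ... | u⊨a , u⊨b = model⇒⟦⟧ a u u⊨a , model⇒⟦⟧ b u u⊨b
  model⇒⟦⟧ (a ∨f b) u u⊨a∨b with max₃≡v2⇒ (val u a) (val u b) u⊨a∨b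
  ... | inj₁ u⊨a = inj₁ (model⇒⟦⟧ a u u⊨a)
  ... | inj₂ u⊨b = inj₂ (model⇒⟦⟧ b u u⊨b)
  model⇒⟦⟧ (a ⇒f b) u u⊨a⇒b =
    material⇒⟦⟧ a b u (imp₃≡v2⇒ _ _ u⊨a⇒b) ,
    ⌈ u ⌉ᵢ , (material⇒⟦⟧ a b ⌈ u ⌉ᵢ (imp₃≡v2⇒ _ _ ⌈u⌉⊨a⇒b) , ⌈⌉ᵢ-classical u) , ⊑-⌈⌉ᵢ u
    where
    ⌈u⌉⊨a⇒b : Model ⌈ u ⌉ᵢ (a ⇒f b)
    ⌈u⌉⊨a⇒b = begin
      imp₃ (val ⌈ u ⌉ᵢ a) (val ⌈ u ⌉ᵢ b) ≡⟨ cong₂ imp₃ (val-⌈⌉ (λ _ → refl) a) (val-⌈⌉ (λ _ → refl) b) ⟩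
      imp₃ ⌈ val u a ⌉ ⌈ val u b ⌉      ≡⟨ sym (⌈⌉-imp₃ (val u a) (val u b)) ⟩
      ⌈ imp₃ (val u a) (val u b) ⌉      ≡⟨ cong ⌈_⌉ u⊨a⇒b ⟩
      v2                                ∎
      where open ≡-Reasoning

  ⟦⟧⇒model : ∀ {n} (a : Formula n) (u : Interp n) → ⟦ a ⟧ u → Model u a
  ⟦⟧⇒model ⊥f       u ()
  ⟦⟧⇒model (atom p) u u∈p = u∈p
  ⟦⟧⇒model (a ∧f b) u (u∈a , u∈b) = ⇒min₃≡v2 (⟦⟧⇒model a u u∈a) (⟦⟧⇒model b u u∈b)
  ⟦⟧⇒model (a ∨f b) u (inj₁ u∈a)  = ⇒max₃≡v2 (inj₁ (⟦⟧⇒model a u u∈a))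
  ⟦⟧⇒model (a ∨f b) u (inj₂ u∈b)  = ⇒max₃≡v2 (inj₂ (⟦⟧⇒model b u u∈b))
  ⟦⟧⇒model (a ⇒f b) u (u∈a⊃b , w , (w∈a⊃b , w-classical) , u⊑w) =
    ⇒imp₃≡v2 _ _ (⟦⟧⇒material a b u u∈a⊃b) (transport (⟦⟧⇒material a b w w∈a⊃b))
    where
    w≡⌈u⌉ : ∀ p → w p ≡ ⌈ u p ⌉
    w≡⌈u⌉ = classical-⊒-≡⌈⌉ᵢ u⊑w w-classical
    transport : MaterialImplication w a b → ⌈ val u a ⌉ ≢ v2 ⊎ ⌈ val u b ⌉ ≡ v2
    transport (inj₁ w⊭a) = inj₁ λ ⌈ua⌉≡v2 → w⊭a (trans (val-⌈⌉ w≡⌈u⌉ a) ⌈ua⌉≡v2)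
    transport (inj₂ w⊨b) = inj₂ (trans (sym (val-⌈⌉ w≡⌈u⌉ b)) w⊨b)

  material⇒⟦⟧ : ∀ {n} (a b : Formula n) (w : Interp n) →
                MaterialImplication w a b → (compl ⟦ a ⟧ ∪ ⟦ b ⟧) w
  material⇒⟦⟧ a b w (inj₁ w⊭a) = inj₁ λ w∈a → w⊭a (⟦⟧⇒model a w w∈a)
  material⇒⟦⟧ a b w (inj₂ w⊨b) = inj₂ (model⇒⟦⟧ b w w⊨b)

  ⟦⟧⇒material : ∀ {n} (a b : Formula n) (w : Interp n) →
                (compl ⟦ a ⟧ ∪ ⟦ b ⟧) w → MaterialImplication w a b
  ⟦⟧⇒material a b w (inj₁ w∉a) = inj₁ λ w⊨a → w∉a (model⇒⟦⟧ a w w⊨a)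
  ⟦⟧⇒material a b w (inj₂ w∈b) = inj₂ (⟦⟧⇒model b w w∈b)

corollary3 : ∀ (n : ℕ) (α β : Formula n) →
    ⟦ α ⟧c ⊆ ⟦ β ⟧c → ⟦ β ⟧ ⊆ ⟦ α ⟧ → StronglyEntails α β
corollary3 n α β αᶜ⊆βᶜ β⊆α γ v (v-classical , v⊨α∧γ , v-minimal) =
  v-classical , v⊨β∧γ , λ u u⊑v u⊨β∧γ → v-minimal u u⊑v (β∧γ⇒α∧γ u u⊨β∧γ)
  where
  v∈α∧γ : ⟦ α ∧f γ ⟧ v
  v∈α∧γ = model⇒⟦⟧ (α ∧f γ) v v⊨α∧γ

  v⊨β∧γ : Model v (β ∧f γ)
  v⊨β∧γ = ⟦⟧⇒model (β ∧f γ) v (proj₁ (αᶜ⊆βᶜ v (proj₁ v∈α∧γ , v-classical)) , proj₂ v∈α∧γ)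

  β∧γ⇒α∧γ : ∀ u → Model u (β ∧f γ) → Model u (α ∧f γ)
  β∧γ⇒α∧γ u u⊨β∧γ with model⇒⟦⟧ (β ∧f γ) u u⊨β∧γ
  ... | u∈β , u∈γ = ⟦⟧⇒model (α ∧f γ) u (β⊆α u u∈β , u∈γ)
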